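{- Let $H_1$ be a connected graph, let $v$ be a vertex of $H_1$ with $d_{H_1}(v)\ge 3$ that is adjacent to a vertex $v_1$ with $d_{H_1}(v_1)=1$, and let $u_1u_2$ be an edge of $H_1$ lying on a cycle of $H_1$. Let $H_2=H_1-\{u_1u_2, vv_1\}+\{u_1v_1,u_2v_1\}$. Then $M_i(H_2)<M_i(H_1)$ for $i=1,2$.
   Context: All graphs are finite and simple. For a graph $G$ with vertex degrees $d(u)$, $M_1(G)=\sum_{u\in V(G)} d(u)^2$ and $M_2(G)=\sum_{uv\in E(G)} d(u)d(v)$. $H-F+F'$ denotes the graph obtained from $H$ by deleting the edge set $F$ and adding the edge set $F'$. -}

module Defs where

open import Data.Bool using (Bool; true; false; _∧_; _∨_; not; if_then_else_)
open import Data.Nat using (ℕ; _*_; _<ᵇ_)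
open import Data.Fin using (Fin; toℕ; _≟_)
open import Data.List using (List; []; _∷_; _++_; [_]; map; allFin)
open import Data.Nat.ListAction using (sum)
open import Data.List.Relation.Unary.Linked using (Linked)
open import Data.List.Relation.Unary.Unique.Propositional using (Unique)
open import Data.Product using (Σ; _×_)
open import Relation.Binary.PropositionalEquality using (_≡_)
open import Relation.Nullary.Decidable using (⌊_⌋)

Graph : ℕ → Set
Graph n = Fin n → Fin n → Bool

record IsSimple {n : ℕ} (G : Graph n) : Set where
  field
    symm   : ∀ x y → G x y ≡ G y x
    irrefl : ∀ x → G x x ≡ false

Adj : {n : ℕ} → Graph n → Fin n → Fin n → Set
Adj G x y = G x y ≡ true

deg : {n : ℕ} → Graph n → Fin n → ℕ
deg {n} G x = sum (map (λ y → if G x y then 1 else 0) (allFin n))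

M1 : {n : ℕ} → Graph n → ℕ
M1 {n} G = sum (map (λ x → deg G x * deg G x) (allFin n))

M2 : {n : ℕ} → Graph n → ℕ
M2 {n} G = sum (map (λ x → sum (map (λ y →
  if G x y ∧ (toℕ x <ᵇ toℕ y) then deg G x * deg G y else 0) (allFin n))) (allFin n))

data Walk {n : ℕ} (G : Graph n) : Fin n → Fin n → Set where
  here : ∀ {x} → Walk G x x
  step : ∀ {x y z} → Adj G x y → Walk G y z → Walk G x z

Connected : {n : ℕ} → Graph n → Set
Connected {n} G = ∀ (x y : Fin n) → Walk G x y

-- the edge u1u2 lies on a cycle: there is a cycle u1, u2, ws..., w, (back to u1)
-- of length ≥ 3 with pairwise distinct vertices.
EdgeOnCycle : {n : ℕ} → Graph n → Fin n → Fin n → Set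
EdgeOnCycle {n} G u1 u2 =
  Σ (List (Fin n)) λ ws → Σ (Fin n) λ w →
    Unique (u1 ∷ u2 ∷ ws ++ [ w ]) ×
    Linked (Adj G) (u1 ∷ u2 ∷ ws ++ [ w ]) ×
    Adj G w u1

isEdge : {n : ℕ} → Fin n → Fin n → Fin n → Fin n → Bool
isEdge a b x y = (⌊ a ≟ x ⌋ ∧ ⌊ b ≟ y ⌋) ∨ (⌊ a ≟ y ⌋ ∧ ⌊ b ≟ x ⌋)

removeAdd : {n : ℕ} → Graph n → (a b c d e f g h : Fin n) → Graph n
removeAdd G a b c d e f g h x y =
  (G x y ∧ not (isEdge a b x y ∨ isEdge c d x y)) ∨ (isEdge e f x y ∨ isEdge g h x y)

-- Both indices are values of the quadratic form Q a d = Σ_{x,y} a(x,y) d(x) d(y): M1 is Q at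
-- the identity matrix and 2·M2 is Q at the adjacency matrix, both evaluated at the degree vector.
-- Deleting u₁u₂, vv₁ and adding u₁v₁, u₂v₁ changes the adjacency matrix by
-- e(u₁v₁) + e(u₂v₁) − e(u₁u₂) − e(vv₁), also when v ∈ {u₁, u₂} (then vv₁ is deleted and added
-- back), so no case distinction is needed: the degree vector moves one unit from v to the leaf v₁.
-- Expanding Q along such a unit shift gives M1(H₂) = M1(H₁) − 2(d(v) − 2) and, with d the
-- degrees in H₁ and T the sum of the H₂-degrees of the H₂-neighbours of v,
--   2 M2(H₂) + 2 (T + d(u₁) d(u₂) + d(v)) = 2 M2(H₁) + 4 (d(u₁) + d(u₂)).
-- Here T ≥ d(v) − 1 ≥ 2, and d(u₁), d(u₂) ≥ 2 because u₁u₂ lies on a cycle, so the left excess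
-- wins by at least 2 (d(u₁) − 2)(d(u₂) − 2) + 2 > 0.

module Submission where

open import Defs
open import Data.Bool using (Bool; true; false; _∧_; _∨_; not; if_then_else_)
open import Data.Bool.Properties using (∧-zeroʳ; ∧-identityʳ; ∨-comm; T-≡)
open import Data.Product using (_×_; _,_; ∃-syntax; proj₁; proj₂)
open import Data.Nat using (ℕ; zero; suc; _+_; _*_; _≤_; _<_; z≤n; s≤s; _<ᵇ_)
open import Data.Nat.Properties hiding (_≟_)
open import Data.Nat.Tactic.RingSolver using (solve-∀)
import Data.Nat.ListAction as ListAction
open import Data.Fin using (Fin; zero; suc; toℕ; _≟_)
open import Data.Fin.Properties using (toℕ-injective)
open import Data.List using (List; []; _∷_; _++_; [_]; map; allFin; tabulate)
import Data.List.Properties as List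
open import Data.List.Relation.Unary.All as All using (All; []; _∷_)
open import Data.List.Relation.Unary.All.Properties using (++⁻ʳ)
open import Data.List.Relation.Unary.Linked using (Linked; [-]; _∷_)
open import Data.List.Relation.Unary.AllPairs using (_∷_)
open import Algebra.Properties.Semiring.Sum +-*-semiring
  using (sum-syntax; ∑-distrib-+; ∑-comm; sum-cong-≗; sum-replicate-zero; *-distribˡ-sum)
open import Relation.Nullary using (¬_; Dec)
open import Relation.Nullary.Decidable using (⌊_⌋; yes; no)
open import Relation.Binary.Definitions using (tri<; tri≈; tri>)
open import Function.Bundles using (Equivalence)
open import Data.Empty using (⊥-elim)
open import Data.Vec.Functional using (Vector)
open import Relation.Binary.PropositionalEquality hiding ([_])

private
  variable
    n : ℕ

sum-tabulate : (f : Fin n → ℕ) → ListAction.sum (tabulate f) ≡ ∑[ i < n ] f i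
sum-tabulate {zero}  f = refl
sum-tabulate {suc n} f = cong (f zero +_) (sum-tabulate (λ i → f (suc i)))

sum-allFin : (f : Fin n → ℕ) → ListAction.sum (map f (allFin n)) ≡ ∑[ i < n ] f i
sum-allFin f = trans (cong ListAction.sum (List.map-tabulate (λ i → i) f)) (sum-tabulate f)

∑-mono-≤ : {f g : Fin n → ℕ} → (∀ i → f i ≤ g i) → ∑[ i < n ] f i ≤ ∑[ i < n ] g i
∑-mono-≤ {zero}  f≤g = z≤n
∑-mono-≤ {suc n} f≤g = +-mono-≤ (f≤g zero) (∑-mono-≤ (λ i → f≤g (suc i)))

+-cong₃ : {α α′ β β′ γ γ′ : ℕ} → α ≡ α′ → β ≡ β′ → γ ≡ γ′ → α + β + γ ≡ α′ + β′ + γ′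
+-cong₃ refl refl refl = refl

∑-distrib-+₃ : (f g h : Vector ℕ n) →
  ∑[ i < n ] (f i + g i + h i) ≡ ∑[ i < n ] f i + ∑[ i < n ] g i + ∑[ i < n ] h i
∑-distrib-+₃ {n} f g h = trans
  (∑-distrib-+ (λ i → f i + g i) h)
  (cong (_+ ∑[ i < n ] h i) (∑-distrib-+ f g))

Matrix : ℕ → Set
Matrix n = Fin n → Fin n → ℕ

∑∑-cong : {f g : Matrix n} → (∀ x y → f x y ≡ g x y) →
  ∑[ x < n ] ∑[ y < n ] f x y ≡ ∑[ x < n ] ∑[ y < n ] g x y
∑∑-cong f≡g = sum-cong-≗ (λ x → sum-cong-≗ (f≡g x))

∑∑-distrib-+ : (f g : Matrix n) →
  ∑[ x < n ] ∑[ y < n ] (f x y + g x y) ≡ ∑[ x < n ] ∑[ y < n ] f x y + ∑[ x < n ] ∑[ y < n ] g x y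
∑∑-distrib-+ {n} f g = trans
  (sum-cong-≗ (λ x → ∑-distrib-+ (f x) (g x)))
  (∑-distrib-+ (λ x → ∑[ y < n ] f x y) (λ x → ∑[ y < n ] g x y))

ind : Bool → ℕ
ind b = if b then 1 else 0

ind-∧ : ∀ b c → ind (b ∧ c) ≡ ind b * ind c
ind-∧ true  c = sym (+-identityʳ (ind c))
ind-∧ false c = refl

ind-∨ : ∀ b c → (b ∧ c) ≡ false → ind (b ∨ c) ≡ ind b + ind c
ind-∨ true  false _ = refl
ind-∨ false c     _ = refl

≟-refl : (p : Fin n) → ⌊ p ≟ p ⌋ ≡ true
≟-refl p with p ≟ p
... | yes _  = refl
... | no p≢p = ⊥-elim (p≢p refl)

≟-≢ : {p x : Fin n} → p ≢ x → ⌊ p ≟ x ⌋ ≡ false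
≟-≢ {p = p} {x} p≢x with p ≟ x
... | yes p≡x = ⊥-elim (p≢x p≡x)
... | no _    = refl

≟-disjoint : {a b : Fin n} → a ≢ b → (y : Fin n) → (⌊ a ≟ y ⌋ ∧ ⌊ b ≟ y ⌋) ≡ false
≟-disjoint {a = a} {b} a≢b y with a ≟ y | b ≟ y
... | yes refl | yes refl = ⊥-elim (a≢b refl)
... | yes _    | no _     = refl
... | no _     | _        = refl

δ : Fin n → Fin n → ℕ
δ p x = ind ⌊ p ≟ x ⌋

δ-refl : (p : Fin n) → δ p p ≡ 1
δ-refl p = cong ind (≟-refl p)

δ-≢ : {p x : Fin n} → p ≢ x → δ p x ≡ 0
δ-≢ p≢x = cong ind (≟-≢ p≢x)

δ-sym : (p x : Fin n) → δ p x ≡ δ x p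
δ-sym p x with p ≟ x | x ≟ p
... | yes _   | yes _   = refl
... | no _    | no _    = refl
... | yes p≡x | no x≢p  = ⊥-elim (x≢p (sym p≡x))
... | no p≢x  | yes x≡p = ⊥-elim (p≢x (sym x≡p))

δ-suc : (p x : Fin n) → δ (suc p) (suc x) ≡ δ p x
δ-suc p x with p ≟ x
... | yes refl = refl
... | no _     = refl

∑-δ : ∀ {n} (p : Fin n) (f : Fin n → ℕ) → ∑[ x < n ] (δ p x * f x) ≡ f p
∑-δ {suc n} zero    f = begin
  1 * f zero + ∑[ x < n ] (0 * f (suc x))
    ≡⟨ cong₂ _+_ (*-identityˡ (f zero)) (sum-cong-≗ (λ x → *-zeroˡ (f (suc x)))) ⟩
  f zero + ∑[ x < n ] 0
    ≡⟨ cong (f zero +_) (sum-replicate-zero n) ⟩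
  f zero + 0
    ≡⟨ +-identityʳ (f zero) ⟩
  f zero
    ∎
  where open ≡-Reasoning
∑-δ {suc n} (suc p) f = begin
  0 * f zero + ∑[ x < n ] (δ (suc p) (suc x) * f (suc x))
    ≡⟨ cong (0 * f zero +_) (sum-cong-≗ (λ x → cong (_* f (suc x)) (δ-suc p x))) ⟩
  ∑[ x < n ] (δ p x * f (suc x))
    ≡⟨ ∑-δ p (λ x → f (suc x)) ⟩
  f (suc p)
    ∎
  where open ≡-Reasoning

∑-δᵀ : (p : Fin n) (f : Vector ℕ n) → ∑[ x < n ] (δ x p * f x) ≡ f p
∑-δᵀ p f = trans (sum-cong-≗ (λ x → cong (_* f x) (δ-sym x p))) (∑-δ p f)

∑-δ-1 : (p : Fin n) → ∑[ x < n ] δ p x ≡ 1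
∑-δ-1 {n} p = trans (sum-cong-≗ (λ x → sym (*-identityʳ (δ p x)))) (∑-δ p (λ _ → 1))

bilinear : Matrix n → Vector ℕ n → Vector ℕ n → ℕ
bilinear {n} a d e = ∑[ x < n ] ∑[ y < n ] (a x y * (d x * e y))

bilinear-cong : {a b : Matrix n} {d d′ e e′ : Vector ℕ n} →
  (∀ x y → a x y ≡ b x y) → (∀ x → d x ≡ d′ x) → (∀ x → e x ≡ e′ x) →
  bilinear a d e ≡ bilinear b d′ e′
bilinear-cong a≡b d≡d′ e≡e′ =
  ∑∑-cong (λ x y → cong₂ _*_ (a≡b x y) (cong₂ _*_ (d≡d′ x) (e≡e′ y)))

bilinear-+ᵐ : (a b : Matrix n) (d e : Vector ℕ n) →
  bilinear (λ x y → a x y + b x y) d e ≡ bilinear a d e + bilinear b d e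
bilinear-+ᵐ a b d e = trans
  (∑∑-cong (λ x y → *-distribʳ-+ (d x * e y) (a x y) (b x y)))
  (∑∑-distrib-+ (λ x y → a x y * (d x * e y)) (λ x y → b x y * (d x * e y)))

bilinear-+ᵐ₃ : (a b c : Matrix n) (d e : Vector ℕ n) →
  bilinear (λ x y → a x y + b x y + c x y) d e ≡ bilinear a d e + bilinear b d e + bilinear c d e
bilinear-+ᵐ₃ a b c d e = trans
  (bilinear-+ᵐ (λ x y → a x y + b x y) c d e)
  (cong (_+ bilinear c d e) (bilinear-+ᵐ a b d e))

bilinear-+ˡ : (a : Matrix n) (d d′ e : Vector ℕ n) →
  bilinear a (λ x → d x + d′ x) e ≡ bilinear a d e + bilinear a d′ e
bilinear-+ˡ a d d′ e = trans
  (∑∑-cong (λ x y → distrib (a x y) (d x) (d′ x) (e y)))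
  (∑∑-distrib-+ (λ x y → a x y * (d x * e y)) (λ x y → a x y * (d′ x * e y)))
  where
  distrib : ∀ α β β′ γ → α * ((β + β′) * γ) ≡ α * (β * γ) + α * (β′ * γ)
  distrib = solve-∀

bilinear-+ʳ : (a : Matrix n) (d e e′ : Vector ℕ n) →
  bilinear a d (λ y → e y + e′ y) ≡ bilinear a d e + bilinear a d e′
bilinear-+ʳ a d e e′ = trans
  (∑∑-cong (λ x y → distrib (a x y) (d x) (e y) (e′ y)))
  (∑∑-distrib-+ (λ x y → a x y * (d x * e y)) (λ x y → a x y * (d x * e′ y)))
  where
  distrib : ∀ α β γ γ′ → α * (β * (γ + γ′)) ≡ α * (β * γ) + α * (β * γ′)
  distrib = solve-∀

bilinear-comm : (a : Matrix n) → (∀ x y → a x y ≡ a y x) → (d e : Vector ℕ n) →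
  bilinear a d e ≡ bilinear a e d
bilinear-comm a a-sym d e = trans
  (∑-comm (λ x y → a x y * (d x * e y)))
  (∑∑-cong (λ y x → cong₂ _*_ (a-sym x y) (*-comm (d x) (e y))))

bilinear-δʳ : (a : Matrix n) (d : Vector ℕ n) (q : Fin n) →
  bilinear a d (δ q) ≡ ∑[ x < n ] (a x q * d x)
bilinear-δʳ a d q = sum-cong-≗ λ x → trans
  (sum-cong-≗ (λ y → swap (a x y) (d x) (δ q y)))
  (∑-δ q (λ y → a x y * d x))
  where
  swap : ∀ α β γ → α * (β * γ) ≡ γ * (α * β)
  swap = solve-∀

bilinear-δδ : (a : Matrix n) (p : Fin n) → bilinear a (δ p) (δ p) ≡ a p p
bilinear-δδ {n} a p = begin
  bilinear a (δ p) (δ p)          ≡⟨ bilinear-δʳ a (δ p) p ⟩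
  ∑[ x < n ] (a x p * δ p x)      ≡⟨ sum-cong-≗ (λ x → *-comm (a x p) (δ p x)) ⟩
  ∑[ x < n ] (δ p x * a x p)      ≡⟨ ∑-δ p (λ x → a x p) ⟩
  a p p                           ∎
  where open ≡-Reasoning

bilinear-+δ : (a : Matrix n) → (∀ x y → a x y ≡ a y x) → (d : Vector ℕ n) (p : Fin n) →
  bilinear a (λ x → d x + δ p x) (λ x → d x + δ p x) ≡
  bilinear a d d + 2 * ∑[ x < n ] (a x p * d x) + a p p
bilinear-+δ {n} a a-sym d p = begin
  bilinear a d+δ d+δ
    ≡⟨ bilinear-+ˡ a d (δ p) d+δ ⟩
  bilinear a d d+δ + bilinear a (δ p) d+δ
    ≡⟨ cong₂ _+_ (bilinear-+ʳ a d d (δ p)) (bilinear-+ʳ a (δ p) d (δ p)) ⟩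
  (bilinear a d d + bilinear a d (δ p)) + (bilinear a (δ p) d + bilinear a (δ p) (δ p))
    ≡⟨ cong₂ (λ t u → (bilinear a d d + bilinear a d (δ p)) + (t + u))
             (bilinear-comm a a-sym (δ p) d) (bilinear-δδ a p) ⟩
  (bilinear a d d + bilinear a d (δ p)) + (bilinear a d (δ p) + a p p)
    ≡⟨ cong (λ s → (bilinear a d d + s) + (s + a p p)) (bilinear-δʳ a d p) ⟩
  (bilinear a d d + s) + (s + a p p)
    ≡⟨ regroup (bilinear a d d) s (a p p) ⟩
  bilinear a d d + 2 * s + a p p
    ∎
  where
  open ≡-Reasoning
  d+δ : Vector ℕ n
  d+δ x = d x + δ p x
  s : ℕ
  s = ∑[ x < n ] (a x p * d x)
  regroup : ∀ β σ α → (β + σ) + (σ + α) ≡ β + 2 * σ + α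
  regroup = solve-∀

bilinear-shift : (a : Matrix n) → (∀ x y → a x y ≡ a y x) →
  {d d′ : Vector ℕ n} {p q : Fin n} → (∀ x → d x + δ p x ≡ d′ x + δ q x) →
  bilinear a d d + 2 * ∑[ x < n ] (a x p * d x) + a p p ≡
  bilinear a d′ d′ + 2 * ∑[ x < n ] (a x q * d′ x) + a q q
bilinear-shift a a-sym {d} {d′} {p} {q} shift = begin
  bilinear a d d + 2 * ∑[ x < _ ] (a x p * d x) + a p p
    ≡⟨ bilinear-+δ a a-sym d p ⟨
  bilinear a (λ x → d x + δ p x) (λ x → d x + δ p x)
    ≡⟨ bilinear-cong {a = a} (λ _ _ → refl) shift shift ⟩
  bilinear a (λ x → d′ x + δ q x) (λ x → d′ x + δ q x)
    ≡⟨ bilinear-+δ a a-sym d′ q ⟩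
  bilinear a d′ d′ + 2 * ∑[ x < _ ] (a x q * d′ x) + a q q
    ∎
  where open ≡-Reasoning

bilinear-δ⊗δ : (p q : Fin n) (d e : Vector ℕ n) → bilinear (λ x y → δ p x * δ q y) d e ≡ d p * e q
bilinear-δ⊗δ {n} p q d e = trans (sum-cong-≗ row) (∑-δ p (λ x → d x * e q))
  where
  open ≡-Reasoning
  regroup : ∀ α β γ ε → (α * β) * (γ * ε) ≡ α * (β * (γ * ε))
  regroup = solve-∀
  row : ∀ x → ∑[ y < n ] ((δ p x * δ q y) * (d x * e y)) ≡ δ p x * (d x * e q)
  row x = begin
    ∑[ y < n ] ((δ p x * δ q y) * (d x * e y))
      ≡⟨ sum-cong-≗ (λ y → regroup (δ p x) (δ q y) (d x) (e y)) ⟩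
    ∑[ y < n ] (δ p x * (δ q y * (d x * e y)))
      ≡⟨ *-distribˡ-sum (δ p x) (λ y → δ q y * (d x * e y)) ⟨
    δ p x * ∑[ y < n ] (δ q y * (d x * e y))
      ≡⟨ cong (δ p x *_) (∑-δ q (λ y → d x * e y)) ⟩
    δ p x * (d x * e q)
      ∎

edge : Fin n → Fin n → Matrix n
edge a b x y = δ a x * δ b y + δ a y * δ b x

edge-sym : (a b x y : Fin n) → edge a b x y ≡ edge a b y x
edge-sym a b x y = +-comm (δ a x * δ b y) (δ a y * δ b x)

edge-∉ʳ : {a b x y : Fin n} → b ≢ x → b ≢ y → edge a b x y ≡ 0
edge-∉ʳ {a = a} {b} {x} {y} b≢x b≢y rewrite δ-≢ b≢x | δ-≢ b≢y =
  cong₂ _+_ (*-zeroʳ (δ a x)) (*-zeroʳ (δ a y))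

edge-∉ˡ : {a b x y : Fin n} → a ≢ x → b ≢ x → edge a b x y ≡ 0
edge-∉ˡ {a = a} {b} {x} {y} a≢x b≢x rewrite δ-≢ a≢x | δ-≢ b≢x = *-zeroʳ (δ a y)

edge-end : {a b : Fin n} → a ≢ b → (y : Fin n) → edge a b b y ≡ δ a y
edge-end {a = a} {b} a≢b y rewrite δ-≢ a≢b | δ-refl b = *-identityʳ (δ a y)

∑-edge : (a b x : Fin n) → ∑[ y < n ] edge a b x y ≡ δ a x + δ b x
∑-edge {n} a b x = begin
  ∑[ y < n ] (δ a x * δ b y + δ a y * δ b x)
    ≡⟨ ∑-distrib-+ (λ y → δ a x * δ b y) (λ y → δ a y * δ b x) ⟩
  ∑[ y < n ] (δ a x * δ b y) + ∑[ y < n ] (δ a y * δ b x)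
    ≡⟨ cong₂ _+_ (*-distribˡ-sum (δ a x) (δ b)) (sym (∑-δ a (λ _ → δ b x))) ⟨
  δ a x * ∑[ y < n ] δ b y + δ b x
    ≡⟨ cong (λ s → δ a x * s + δ b x) (∑-δ-1 b) ⟩
  δ a x * 1 + δ b x
    ≡⟨ cong (_+ δ b x) (*-identityʳ (δ a x)) ⟩
  δ a x + δ b x
    ∎
  where open ≡-Reasoning

bilinear-edge : (a b : Fin n) (d : Vector ℕ n) → bilinear (edge a b) d d ≡ 2 * (d a * d b)
bilinear-edge a b d = begin
  bilinear (edge a b) d d
    ≡⟨ bilinear-+ᵐ (λ x y → δ a x * δ b y) (λ x y → δ a y * δ b x) d d ⟩
  bilinear (λ x y → δ a x * δ b y) d d + bilinear (λ x y → δ a y * δ b x) d d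
    ≡⟨ cong (bilinear (λ x y → δ a x * δ b y) d d +_)
            (bilinear-cong {d = d} {e = d} (λ x y → *-comm (δ a y) (δ b x)) (λ _ → refl) (λ _ → refl)) ⟩
  bilinear (λ x y → δ a x * δ b y) d d + bilinear (λ x y → δ b x * δ a y) d d
    ≡⟨ cong₂ _+_ (bilinear-δ⊗δ a b d d) (bilinear-δ⊗δ b a d d) ⟩
  d a * d b + d b * d a
    ≡⟨ cong (d a * d b +_) (trans (*-comm (d b) (d a)) (sym (+-identityʳ (d a * d b)))) ⟩
  2 * (d a * d b)
    ∎
  where open ≡-Reasoning

isEdge-sym : (a b x y : Fin n) → isEdge a b x y ≡ isEdge a b y x
isEdge-sym a b x y = ∨-comm (⌊ a ≟ x ⌋ ∧ ⌊ b ≟ y ⌋) (⌊ a ≟ y ⌋ ∧ ⌊ b ≟ x ⌋)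

isEdge-∉ʳ : {a b x y : Fin n} → b ≢ x → b ≢ y → isEdge a b x y ≡ false
isEdge-∉ʳ {a = a} {b} {x} {y} b≢x b≢y
  rewrite ≟-≢ b≢x | ≟-≢ b≢y | ∧-zeroʳ ⌊ a ≟ x ⌋ | ∧-zeroʳ ⌊ a ≟ y ⌋ = refl

isEdge-∉ˡ : {a b x y : Fin n} → a ≢ x → b ≢ x → isEdge a b x y ≡ false
isEdge-∉ˡ {a = a} {b} {x} {y} a≢x b≢x
  rewrite ≟-≢ a≢x | ≟-≢ b≢x | ∧-zeroʳ ⌊ a ≟ y ⌋ = refl

isEdge-end : {a b : Fin n} → a ≢ b → (y : Fin n) → isEdge a b b y ≡ ⌊ a ≟ y ⌋
isEdge-end {a = a} {b} a≢b y rewrite ≟-≢ a≢b | ≟-refl b = ∧-identityʳ ⌊ a ≟ y ⌋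

isEdge-irrefl : {a b : Fin n} → a ≢ b → (x : Fin n) → isEdge a b x x ≡ false
isEdge-irrefl {a = a} {b} a≢b x with a ≟ x | b ≟ x
... | yes refl | yes refl = ⊥-elim (a≢b refl)
... | yes _    | no _     = refl
... | no _     | yes _    = refl
... | no _     | no _     = refl

isEdge-edge : {a b : Fin n} → a ≢ b → (x y : Fin n) → ind (isEdge a b x y) ≡ edge a b x y
isEdge-edge {a = a} {b} a≢b x y = begin
  ind ((⌊ a ≟ x ⌋ ∧ ⌊ b ≟ y ⌋) ∨ (⌊ a ≟ y ⌋ ∧ ⌊ b ≟ x ⌋))
    ≡⟨ ind-∨ (⌊ a ≟ x ⌋ ∧ ⌊ b ≟ y ⌋) (⌊ a ≟ y ⌋ ∧ ⌊ b ≟ x ⌋) disjoint ⟩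
  ind (⌊ a ≟ x ⌋ ∧ ⌊ b ≟ y ⌋) + ind (⌊ a ≟ y ⌋ ∧ ⌊ b ≟ x ⌋)
    ≡⟨ cong₂ _+_ (ind-∧ ⌊ a ≟ x ⌋ ⌊ b ≟ y ⌋) (ind-∧ ⌊ a ≟ y ⌋ ⌊ b ≟ x ⌋) ⟩
  edge a b x y
    ∎
  where
  open ≡-Reasoning
  disjoint : ((⌊ a ≟ x ⌋ ∧ ⌊ b ≟ y ⌋) ∧ (⌊ a ≟ y ⌋ ∧ ⌊ b ≟ x ⌋)) ≡ false
  disjoint with a ≟ x | b ≟ y
  ... | yes refl | yes refl rewrite ≟-≢ a≢b = refl
  ... | yes _    | no _     = refl
  ... | no _     | _        = refl

isEdge⇒Adj : {G : Graph n} → IsSimple G → {a b x y : Fin n} →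
  Adj G a b → isEdge a b x y ≡ true → Adj G x y
isEdge⇒Adj simple {a} {b} {x} {y} ab e with a ≟ x | b ≟ y | a ≟ y | b ≟ x
... | yes refl | yes refl | _        | _        = ab
... | _        | _        | yes refl | yes refl = trans (IsSimple.symm simple b a) ab

adj : Graph n → Matrix n
adj G x y = ind (G x y)

adj-sym : {G : Graph n} → IsSimple G → ∀ x y → adj G x y ≡ adj G y x
adj-sym simple x y = cong ind (IsSimple.symm simple x y)

adj⇒≢ : {G : Graph n} → IsSimple G → {x y : Fin n} → Adj G x y → x ≢ y
adj⇒≢ {G = G} simple {x} xy refl with trans (sym xy) (IsSimple.irrefl simple x)
... | ()

deg-∑ : (G : Graph n) (x : Fin n) → deg G x ≡ ∑[ y < n ] adj G x y
deg-∑ G x = sum-allFin (adj G x)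

δ-≤-adj : {G : Graph n} {x a : Fin n} → Adj G x a → ∀ y → δ a y ≤ adj G x y
δ-≤-adj {G = G} {x} {a} xa y with a ≟ y
... | yes refl rewrite xa = ≤-refl
... | no _     = z≤n

adj⇒deg≥1 : (G : Graph n) {x a : Fin n} → Adj G x a → 1 ≤ deg G x
adj⇒deg≥1 {n} G {x} {a} xa = begin
  1                       ≡⟨ ∑-δ-1 a ⟨
  ∑[ y < n ] δ a y        ≤⟨ ∑-mono-≤ (δ-≤-adj {G = G} xa) ⟩
  ∑[ y < n ] adj G x y    ≡⟨ deg-∑ G x ⟨
  deg G x                 ∎
  where open ≤-Reasoning

adj⇒deg≥2 : (G : Graph n) {x a b : Fin n} → a ≢ b → Adj G x a → Adj G x b → 2 ≤ deg G x
adj⇒deg≥2 {n} G {x} {a} {b} a≢b xa xb = begin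
  2                                   ≡⟨ cong₂ _+_ (∑-δ-1 a) (∑-δ-1 b) ⟨
  ∑[ y < n ] δ a y + ∑[ y < n ] δ b y ≡⟨ ∑-distrib-+ {n} (δ a) (δ b) ⟨
  ∑[ y < n ] (δ a y + δ b y)          ≤⟨ ∑-mono-≤ two-neighbours ⟩
  ∑[ y < n ] adj G x y                ≡⟨ deg-∑ G x ⟨
  deg G x                             ∎
  where
  open ≤-Reasoning
  two-neighbours : ∀ y → δ a y + δ b y ≤ adj G x y
  two-neighbours y with a ≟ y | b ≟ y
  ... | yes refl | yes refl = ⊥-elim (a≢b refl)
  ... | yes refl | no _     rewrite xa = ≤-refl
  ... | no _     | yes refl rewrite xb = ≤-refl
  ... | no _     | no _     = z≤n

leaf-adj : (G : Graph n) {x a : Fin n} → deg G x ≡ 1 → Adj G x a → ∀ y → G x y ≡ ⌊ a ≟ y ⌋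
leaf-adj G {x} {a} leaf xa y with a ≟ y | G x y in xy
... | yes refl | _     = trans (sym xy) xa
... | no _     | false = refl
... | no a≢y   | true  = ⊥-elim (1+n≰n (subst (2 ≤_) leaf (adj⇒deg≥2 G a≢y xa xy)))

deg≤∑-neighbour-deg : {G : Graph n} → IsSimple G → (p : Fin n) →
  deg G p ≤ ∑[ x < n ] (adj G x p * deg G x)
deg≤∑-neighbour-deg {n} {G} simple p = begin
  deg G p                           ≡⟨ deg-∑ G p ⟩
  ∑[ x < n ] adj G p x              ≡⟨ sum-cong-≗ (adj-sym simple p) ⟩
  ∑[ x < n ] adj G x p              ≤⟨ ∑-mono-≤ weighted ⟩
  ∑[ x < n ] (adj G x p * deg G x)  ∎
  where
  open ≤-Reasoning
  weighted : ∀ x → adj G x p ≤ adj G x p * deg G x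
  weighted x with G x p in xp
  ... | false = z≤n
  ... | true  = ≤-trans (adj⇒deg≥1 G xp) (≤-reflexive (sym (*-identityˡ (deg G x))))

successor-on-path : {G : Graph n} (ws : List (Fin n)) {w x y : Fin n} →
  All (y ≢_) (ws ++ [ w ]) → Linked (Adj G) (x ∷ ws ++ [ w ]) → ∃[ z ] Adj G x z × y ≢ z
successor-on-path []      (y≢w ∷ []) (xw ∷ [-]) = _ , xw , y≢w
successor-on-path (z ∷ _) (y≢z ∷ _)  (xz ∷ _)   = z , xz , y≢z

edgeOnCycle⇒deg≥2 : {G : Graph n} → IsSimple G → {u₁ u₂ : Fin n} → Adj G u₁ u₂ →
  EdgeOnCycle G u₁ u₂ → 2 ≤ deg G u₁ × 2 ≤ deg G u₂
edgeOnCycle⇒deg≥2 {G = G} simple {u₁} {u₂} u₁u₂ (ws , w , (u₁≢ ∷ u₂≢ ∷ _) , (_ ∷ path) , wu₁)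
  with successor-on-path ws (All.tail u₁≢) path
... | z , u₂z , u₁≢z =
  adj⇒deg≥2 G (All.head (++⁻ʳ ws u₂≢)) u₁u₂ (trans (IsSimple.symm simple u₁ w) wu₁) ,
  adj⇒deg≥2 G u₁≢z (trans (IsSimple.symm simple u₂ u₁) u₁u₂) u₂z

M1-bilinear : (G : Graph n) → M1 G ≡ bilinear δ (deg G) (deg G)
M1-bilinear G = trans
  (sum-allFin (λ x → deg G x * deg G x))
  (sym (sum-cong-≗ (λ x → ∑-δ x (λ y → deg G x * deg G y))))

M2-summand : Graph n → Matrix n
M2-summand G x y = if G x y ∧ (toℕ x <ᵇ toℕ y) then deg G x * deg G y else 0

M2-∑∑ : (G : Graph n) → M2 G ≡ ∑[ x < n ] ∑[ y < n ] M2-summand G x y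
M2-∑∑ {n} G = trans
  (sum-allFin (λ x → ListAction.sum (map (M2-summand G x) (allFin n))))
  (sum-cong-≗ (λ x → sum-allFin (M2-summand G x)))

<ᵇ-true : {m k : ℕ} → m < k → (m <ᵇ k) ≡ true
<ᵇ-true m<k = Equivalence.to T-≡ (<⇒<ᵇ m<k)

<ᵇ-false : {m k : ℕ} → ¬ m < k → (m <ᵇ k) ≡ false
<ᵇ-false {m} {k} m≮k with m <ᵇ k in m<ᵇk
... | false = refl
... | true  = ⊥-elim (m≮k (<ᵇ⇒< m k (Equivalence.from T-≡ m<ᵇk)))

adj-M2-summand : {G : Graph n} → IsSimple G → ∀ x y →
  adj G x y * (deg G x * deg G y) ≡ M2-summand G x y + M2-summand G y x
adj-M2-summand {G = G} simple x y rewrite IsSimple.symm simple y x with G x y in xy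
... | false = refl
... | true with <-cmp (toℕ x) (toℕ y)
...   | tri< x<y _ y≮x rewrite <ᵇ-true x<y | <ᵇ-false y≮x =
  trans (*-identityˡ _) (sym (+-identityʳ _))
...   | tri> x≮y _ y<x rewrite <ᵇ-false x≮y | <ᵇ-true y<x =
  trans (*-identityˡ _) (*-comm (deg G x) (deg G y))
...   | tri≈ _ x≡y _ with toℕ-injective x≡y
...     | refl with trans (sym xy) (IsSimple.irrefl simple x)
...       | ()

M2-bilinear : {G : Graph n} → IsSimple G → 2 * M2 G ≡ bilinear (adj G) (deg G) (deg G)
M2-bilinear {n} {G} simple = begin
  2 * M2 G
    ≡⟨ cong (M2 G +_) (+-identityʳ (M2 G)) ⟩
  M2 G + M2 G
    ≡⟨ cong₂ _+_ (M2-∑∑ G) (trans (M2-∑∑ G) (∑-comm (M2-summand G))) ⟩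
  ∑[ x < n ] ∑[ y < n ] M2-summand G x y + ∑[ x < n ] ∑[ y < n ] M2-summand G y x
    ≡⟨ ∑∑-distrib-+ (M2-summand G) (λ x y → M2-summand G y x) ⟨
  ∑[ x < n ] ∑[ y < n ] (M2-summand G x y + M2-summand G y x)
    ≡⟨ ∑∑-cong (adj-M2-summand simple) ⟨
  bilinear (adj G) (deg G) (deg G)
    ∎
  where open ≡-Reasoning

excess⇒< : {q q′ s s′ : ℕ} → q + s ≡ q′ + s′ → s′ < s → q < q′
excess⇒< {q} {q′} {s} {s′} eq s′<s = +-cancelʳ-≤ s′ (suc q) q′ (begin
  suc q + s′  ≡⟨ +-suc q s′ ⟨
  q + suc s′  ≤⟨ +-monoʳ-≤ q s′<s ⟩
  q + s       ≡⟨ eq ⟩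
  q′ + s′     ∎)
  where open ≤-Reasoning

4[a+b]<2[t+ab+d] : ∀ {t a b d} → 2 ≤ t → 2 ≤ a → 2 ≤ b → 3 ≤ d → 4 * (a + b) < 2 * (t + a * b + d)
4[a+b]<2[t+ab+d] {suc (suc t)} {suc (suc a)} {suc (suc b)} {suc (suc (suc d))}
  (s≤s (s≤s z≤n)) (s≤s (s≤s z≤n)) (s≤s (s≤s z≤n)) (s≤s (s≤s (s≤s z≤n))) =
  ≤-trans (m≤m+n _ (1 + 2 * t + 2 * d + 2 * (a * b))) (≤-reflexive (sym (expand t a b d)))
  where
  expand : ∀ t a b d → 2 * ((2 + t) + (2 + a) * (2 + b) + (3 + d)) ≡
                       suc (4 * ((2 + a) + (2 + b))) + (1 + 2 * t + 2 * d + 2 * (a * b))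
  expand = solve-∀

module Rerouting {n : ℕ} (H : Graph n) (H-simple : IsSimple H) (v v₁ u₁ u₂ : Fin n)
  (vv₁ : Adj H v v₁) (v₁-leaf : deg H v₁ ≡ 1) (u₁u₂ : Adj H u₁ u₂)
  (u₁≢v₁ : u₁ ≢ v₁) (u₂≢v₁ : u₂ ≢ v₁) where

  K : Graph n
  K = removeAdd H u₁ u₂ v v₁ u₁ v₁ u₂ v₁

  u₁≢u₂ : u₁ ≢ u₂
  u₁≢u₂ = adj⇒≢ H-simple u₁u₂

  v≢v₁ : v ≢ v₁
  v≢v₁ = adj⇒≢ H-simple vv₁

  K-simple : IsSimple K
  K-simple = record { symm = K-symm ; irrefl = K-irrefl }
    where
    K-symm : ∀ x y → K x y ≡ K y x
    K-symm x y rewrite IsSimple.symm H-simple x y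
      | isEdge-sym u₁ u₂ x y | isEdge-sym v v₁ x y | isEdge-sym u₁ v₁ x y | isEdge-sym u₂ v₁ x y = refl
    K-irrefl : ∀ x → K x x ≡ false
    K-irrefl x rewrite IsSimple.irrefl H-simple x
      | isEdge-irrefl u₁≢v₁ x | isEdge-irrefl u₂≢v₁ x = refl

  H-v₁ : ∀ y → H v₁ y ≡ ⌊ v ≟ y ⌋
  H-v₁ = leaf-adj H v₁-leaf (trans (IsSimple.symm H-simple v₁ v) vv₁)

  adj-K-v₁ : ∀ y → adj K v₁ y ≡ δ u₁ y + δ u₂ y
  adj-K-v₁ y rewrite H-v₁ y | isEdge-∉ˡ {y = y} u₁≢v₁ u₂≢v₁
    | isEdge-end v≢v₁ y | isEdge-end u₁≢v₁ y | isEdge-end u₂≢v₁ y =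
    trans (cong ind (unlinked ⌊ v ≟ y ⌋)) (ind-∨ ⌊ u₁ ≟ y ⌋ ⌊ u₂ ≟ y ⌋ (≟-disjoint u₁≢u₂ y))
    where
    unlinked : ∀ c {r} → ((c ∧ not (false ∨ c)) ∨ r) ≡ r
    unlinked true  = refl
    unlinked false = refl

  adj-K-at-v₁ : ∀ y → adj K v₁ y + edge u₁ u₂ v₁ y + edge v v₁ v₁ y ≡
                      adj H v₁ y + edge u₁ v₁ v₁ y + edge u₂ v₁ v₁ y
  adj-K-at-v₁ y rewrite adj-K-v₁ y | edge-∉ˡ {y = y} u₁≢v₁ u₂≢v₁ | H-v₁ y
    | edge-end v≢v₁ y | edge-end u₁≢v₁ y | edge-end u₂≢v₁ y = regroup (δ u₁ y) (δ u₂ y) (δ v y)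
    where
    regroup : ∀ α β γ → α + β + 0 + γ ≡ γ + α + β
    regroup = solve-∀

  adj-K-off-v₁ : ∀ {x y} → v₁ ≢ x → v₁ ≢ y →
    adj K x y + edge u₁ u₂ x y + edge v v₁ x y ≡ adj H x y + edge u₁ v₁ x y + edge u₂ v₁ x y
  adj-K-off-v₁ {x} {y} v₁≢x v₁≢y
    rewrite isEdge-∉ʳ {a = v} v₁≢x v₁≢y | isEdge-∉ʳ {a = u₁} v₁≢x v₁≢y
      | isEdge-∉ʳ {a = u₂} v₁≢x v₁≢y | edge-∉ʳ {a = v} v₁≢x v₁≢y
      | edge-∉ʳ {a = u₁} v₁≢x v₁≢y | edge-∉ʳ {a = u₂} v₁≢x v₁≢y
      | sym (isEdge-edge u₁≢u₂ x y) =
    removed (H x y) (isEdge u₁ u₂ x y) (isEdge⇒Adj H-simple u₁u₂)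
    where
    removed : ∀ g p → (p ≡ true → g ≡ true) →
      ind ((g ∧ not (p ∨ false)) ∨ (false ∨ false)) + ind p + 0 ≡ ind g + 0 + 0
    removed true  true  _   = refl
    removed true  false _   = refl
    removed false false _   = refl
    removed false true  p⇒g with p⇒g refl
    ... | ()

  adj-K : ∀ x y → adj K x y + edge u₁ u₂ x y + edge v v₁ x y ≡
                  adj H x y + edge u₁ v₁ x y + edge u₂ v₁ x y
  adj-K x y = by-position (v₁ ≟ x) (v₁ ≟ y)
    where
    open ≡-Reasoning
    by-position : Dec (v₁ ≡ x) → Dec (v₁ ≡ y) →
      adj K x y + edge u₁ u₂ x y + edge v v₁ x y ≡ adj H x y + edge u₁ v₁ x y + edge u₂ v₁ x y
    by-position (yes refl) _          = adj-K-at-v₁ y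
    by-position (no v₁≢x)  (no v₁≢y)  = adj-K-off-v₁ v₁≢x v₁≢y
    by-position (no _)     (yes refl) = begin
      adj K x v₁ + edge u₁ u₂ x v₁ + edge v v₁ x v₁
        ≡⟨ +-cong₃ (adj-sym K-simple x v₁) (edge-sym u₁ u₂ x v₁) (edge-sym v v₁ x v₁) ⟩
      adj K v₁ x + edge u₁ u₂ v₁ x + edge v v₁ v₁ x
        ≡⟨ adj-K-at-v₁ x ⟩
      adj H v₁ x + edge u₁ v₁ v₁ x + edge u₂ v₁ v₁ x
        ≡⟨ +-cong₃ (adj-sym H-simple v₁ x) (edge-sym u₁ v₁ v₁ x) (edge-sym u₂ v₁ v₁ x) ⟩
      adj H x v₁ + edge u₁ v₁ x v₁ + edge u₂ v₁ x v₁
        ∎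

  deg-K : ∀ x → deg K x + δ v x ≡ deg H x + δ v₁ x
  deg-K x = +-cancelʳ-≡ (δ u₁ x + δ u₂ x + δ v₁ x) _ _ (begin
    deg K x + δ v x + (δ u₁ x + δ u₂ x + δ v₁ x)
      ≡⟨ regroupK (deg K x) (δ u₁ x) (δ u₂ x) (δ v x) (δ v₁ x) ⟩
    deg K x + (δ u₁ x + δ u₂ x) + (δ v x + δ v₁ x)
      ≡⟨ +-cong₃ (sym (deg-∑ K x)) (∑-edge u₁ u₂ x) (∑-edge v v₁ x) ⟨
    ∑[ y < n ] adj K x y + ∑[ y < n ] edge u₁ u₂ x y + ∑[ y < n ] edge v v₁ x y
      ≡⟨ ∑-distrib-+₃ (adj K x) (edge u₁ u₂ x) (edge v v₁ x) ⟨
    ∑[ y < n ] (adj K x y + edge u₁ u₂ x y + edge v v₁ x y)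
      ≡⟨ sum-cong-≗ (adj-K x) ⟩
    ∑[ y < n ] (adj H x y + edge u₁ v₁ x y + edge u₂ v₁ x y)
      ≡⟨ ∑-distrib-+₃ (adj H x) (edge u₁ v₁ x) (edge u₂ v₁ x) ⟩
    ∑[ y < n ] adj H x y + ∑[ y < n ] edge u₁ v₁ x y + ∑[ y < n ] edge u₂ v₁ x y
      ≡⟨ +-cong₃ (sym (deg-∑ H x)) (∑-edge u₁ v₁ x) (∑-edge u₂ v₁ x) ⟩
    deg H x + (δ u₁ x + δ v₁ x) + (δ u₂ x + δ v₁ x)
      ≡⟨ regroupH (deg H x) (δ u₁ x) (δ u₂ x) (δ v₁ x) ⟩
    deg H x + δ v₁ x + (δ u₁ x + δ u₂ x + δ v₁ x)
      ∎)
    where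
    open ≡-Reasoning
    regroupK : ∀ d a b c e → d + c + (a + b + e) ≡ d + (a + b) + (c + e)
    regroupK = solve-∀
    regroupH : ∀ d a b e → d + (a + e) + (b + e) ≡ d + e + (a + b + e)
    regroupH = solve-∀

  deg-K-v : deg K v + 1 ≡ deg H v
  deg-K-v = begin
    deg K v + 1        ≡⟨ cong (deg K v +_) (δ-refl v) ⟨
    deg K v + δ v v    ≡⟨ deg-K v ⟩
    deg H v + δ v₁ v   ≡⟨ cong (deg H v +_) (δ-≢ (≢-sym v≢v₁)) ⟩
    deg H v + 0        ≡⟨ +-identityʳ (deg H v) ⟩
    deg H v            ∎
    where open ≡-Reasoning

  M1-K : M1 K + 2 * deg K v ≡ M1 H + 2
  M1-K = +-cancelʳ-≡ 1 _ _ (begin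
    M1 K + 2 * deg K v + 1
      ≡⟨ +-cong₃ (M1-bilinear K) (cong (2 *_) (sym (∑-δᵀ v (deg K)))) (sym (δ-refl v)) ⟩
    bilinear δ (deg K) (deg K) + 2 * ∑[ x < n ] (δ x v * deg K x) + δ v v
      ≡⟨ bilinear-shift δ δ-sym deg-K ⟩
    bilinear δ (deg H) (deg H) + 2 * ∑[ x < n ] (δ x v₁ * deg H x) + δ v₁ v₁
      ≡⟨ +-cong₃ (sym (M1-bilinear H)) (cong (2 *_) (trans (∑-δᵀ v₁ (deg H)) v₁-leaf)) (δ-refl v₁) ⟩
    M1 H + 2 + 1
      ∎)
    where open ≡-Reasoning

  adj-K-irrefl : ∀ x → adj K x x ≡ 0
  adj-K-irrefl x = cong ind (IsSimple.irrefl K-simple x)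

  ∑-neighbour-deg-K-v₁ : ∑[ x < n ] (adj K x v₁ * deg H x) ≡ deg H u₁ + deg H u₂
  ∑-neighbour-deg-K-v₁ = begin
    ∑[ x < n ] (adj K x v₁ * deg H x)
      ≡⟨ sum-cong-≗ (λ x → cong (_* deg H x) (trans (adj-sym K-simple x v₁) (adj-K-v₁ x))) ⟩
    ∑[ x < n ] ((δ u₁ x + δ u₂ x) * deg H x)
      ≡⟨ sum-cong-≗ (λ x → *-distribʳ-+ (deg H x) (δ u₁ x) (δ u₂ x)) ⟩
    ∑[ x < n ] (δ u₁ x * deg H x + δ u₂ x * deg H x)
      ≡⟨ ∑-distrib-+ (λ x → δ u₁ x * deg H x) (λ x → δ u₂ x * deg H x) ⟩
    ∑[ x < n ] (δ u₁ x * deg H x) + ∑[ x < n ] (δ u₂ x * deg H x)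
      ≡⟨ cong₂ _+_ (∑-δ u₁ (deg H)) (∑-δ u₂ (deg H)) ⟩
    deg H u₁ + deg H u₂
      ∎
    where open ≡-Reasoning

  bilinear-K-degrees : bilinear (adj K) (deg K) (deg K) + 2 * ∑[ x < n ] (adj K x v * deg K x) ≡
                       bilinear (adj K) (deg H) (deg H) + 2 * (deg H u₁ + deg H u₂)
  bilinear-K-degrees = begin
    Bᴷ + 2 * Tᴷ                  ≡⟨ +-identityʳ (Bᴷ + 2 * Tᴷ) ⟨
    Bᴷ + 2 * Tᴷ + 0              ≡⟨ cong (Bᴷ + 2 * Tᴷ +_) (adj-K-irrefl v) ⟨
    Bᴷ + 2 * Tᴷ + adj K v v      ≡⟨ bilinear-shift (adj K) (adj-sym K-simple) deg-K ⟩
    Bᴴ + 2 * Tᴴ + adj K v₁ v₁    ≡⟨ cong₂ (λ t a → Bᴴ + 2 * t + a) ∑-neighbour-deg-K-v₁ (adj-K-irrefl v₁) ⟩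
    Bᴴ + 2 * S + 0               ≡⟨ +-identityʳ (Bᴴ + 2 * S) ⟩
    Bᴴ + 2 * S                   ∎
    where
    open ≡-Reasoning
    Bᴷ Bᴴ Tᴷ Tᴴ S : ℕ
    Bᴷ = bilinear (adj K) (deg K) (deg K)
    Bᴴ = bilinear (adj K) (deg H) (deg H)
    Tᴷ = ∑[ x < n ] (adj K x v * deg K x)
    Tᴴ = ∑[ x < n ] (adj K x v₁ * deg H x)
    S = deg H u₁ + deg H u₂

  bilinear-K-edges : bilinear (adj K) (deg H) (deg H) + 2 * (deg H u₁ * deg H u₂) + 2 * deg H v ≡
                     bilinear (adj H) (deg H) (deg H) + 2 * (deg H u₁ + deg H u₂)
  bilinear-K-edges = begin
    bilinear (adj K) d d + 2 * (d u₁ * d u₂) + 2 * d v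
      ≡⟨ +-cong₃ refl (bilinear-edge u₁ u₂ d) edge-vv₁ ⟨
    bilinear (adj K) d d + bilinear (edge u₁ u₂) d d + bilinear (edge v v₁) d d
      ≡⟨ bilinear-+ᵐ₃ (adj K) (edge u₁ u₂) (edge v v₁) d d ⟨
    bilinear (λ x y → adj K x y + edge u₁ u₂ x y + edge v v₁ x y) d d
      ≡⟨ bilinear-cong {d = d} {e = d} adj-K (λ _ → refl) (λ _ → refl) ⟩
    bilinear (λ x y → adj H x y + edge u₁ v₁ x y + edge u₂ v₁ x y) d d
      ≡⟨ bilinear-+ᵐ₃ (adj H) (edge u₁ v₁) (edge u₂ v₁) d d ⟩
    bilinear (adj H) d d + bilinear (edge u₁ v₁) d d + bilinear (edge u₂ v₁) d d
      ≡⟨ +-cong₃ refl (bilinear-edge u₁ v₁ d) (bilinear-edge u₂ v₁ d) ⟩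
    bilinear (adj H) d d + 2 * (d u₁ * d v₁) + 2 * (d u₂ * d v₁)
      ≡⟨ cong (λ e → bilinear (adj H) d d + 2 * (d u₁ * e) + 2 * (d u₂ * e)) v₁-leaf ⟩
    bilinear (adj H) d d + 2 * (d u₁ * 1) + 2 * (d u₂ * 1)
      ≡⟨ regroup (bilinear (adj H) d d) (d u₁) (d u₂) ⟩
    bilinear (adj H) d d + 2 * (d u₁ + d u₂)
      ∎
    where
    open ≡-Reasoning
    d : Vector ℕ n
    d = deg H
    edge-vv₁ : bilinear (edge v v₁) d d ≡ 2 * d v
    edge-vv₁ = begin
      bilinear (edge v v₁) d d   ≡⟨ bilinear-edge v v₁ d ⟩
      2 * (d v * d v₁)           ≡⟨ cong (λ e → 2 * (d v * e)) v₁-leaf ⟩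
      2 * (d v * 1)              ≡⟨ cong (2 *_) (*-identityʳ (d v)) ⟩
      2 * d v                    ∎
    regroup : ∀ β h₁ h₂ → β + 2 * (h₁ * 1) + 2 * (h₂ * 1) ≡ β + 2 * (h₁ + h₂)
    regroup = solve-∀

  2≤deg-K-v : 3 ≤ deg H v → 2 ≤ deg K v
  2≤deg-K-v 3≤D = +-cancelʳ-≤ 1 2 (deg K v) (subst (3 ≤_) (sym deg-K-v) 3≤D)

  M1-decreases : 3 ≤ deg H v → M1 K < M1 H
  M1-decreases 3≤D = excess⇒< M1-K (<-≤-trans (s≤s (s≤s (s≤s z≤n))) (*-monoʳ-≤ 2 (2≤deg-K-v 3≤D)))

  M2-K : 2 * M2 K + 2 * (∑[ x < n ] (adj K x v * deg K x) + deg H u₁ * deg H u₂ + deg H v) ≡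
         2 * M2 H + 4 * (deg H u₁ + deg H u₂)
  M2-K = begin
    2 * M2 K + 2 * (T + P + D)
      ≡⟨ cong (_+ 2 * (T + P + D)) (M2-bilinear K-simple) ⟩
    bilinear (adj K) (deg K) (deg K) + 2 * (T + P + D)
      ≡⟨ split (bilinear (adj K) (deg K) (deg K)) T P D ⟩
    bilinear (adj K) (deg K) (deg K) + 2 * T + (2 * P + 2 * D)
      ≡⟨ cong (_+ (2 * P + 2 * D)) bilinear-K-degrees ⟩
    bilinear (adj K) (deg H) (deg H) + 2 * S + (2 * P + 2 * D)
      ≡⟨ swap (bilinear (adj K) (deg H) (deg H)) S P D ⟩
    bilinear (adj K) (deg H) (deg H) + 2 * P + 2 * D + 2 * S
      ≡⟨ cong (_+ 2 * S) bilinear-K-edges ⟩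
    bilinear (adj H) (deg H) (deg H) + 2 * S + 2 * S
      ≡⟨ cong (λ q → q + 2 * S + 2 * S) (M2-bilinear H-simple) ⟨
    2 * M2 H + 2 * S + 2 * S
      ≡⟨ +-assoc (2 * M2 H) (2 * S) (2 * S) ⟩
    2 * M2 H + (2 * S + 2 * S)
      ≡⟨ cong (2 * M2 H +_) (*-distribʳ-+ S 2 2) ⟨
    2 * M2 H + 4 * S
      ∎
    where
    open ≡-Reasoning
    T P D S : ℕ
    T = ∑[ x < n ] (adj K x v * deg K x)
    P = deg H u₁ * deg H u₂
    D = deg H v
    S = deg H u₁ + deg H u₂
    split : ∀ β t p d → β + 2 * (t + p + d) ≡ β + 2 * t + (2 * p + 2 * d)
    split = solve-∀
    swap : ∀ β s p d → β + 2 * s + (2 * p + 2 * d) ≡ β + 2 * p + 2 * d + 2 * s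
    swap = solve-∀

  M2-decreases : 3 ≤ deg H v → 2 ≤ deg H u₁ → 2 ≤ deg H u₂ → M2 K < M2 H
  M2-decreases 3≤D 2≤h₁ 2≤h₂ = *-cancelˡ-< 2 (M2 K) (M2 H) (excess⇒< M2-K
    (4[a+b]<2[t+ab+d] (≤-trans (2≤deg-K-v 3≤D) (deg≤∑-neighbour-deg K-simple v)) 2≤h₁ 2≤h₂ 3≤D))

lemma2p3 : {n : ℕ} (H₁ : Graph n) → IsSimple H₁ → Connected H₁ →
    (v v₁ u₁ u₂ : Fin n) →
    3 ≤ deg H₁ v → Adj H₁ v v₁ → deg H₁ v₁ ≡ 1 →
    Adj H₁ u₁ u₂ → EdgeOnCycle H₁ u₁ u₂ →
    let H₂ = removeAdd H₁ u₁ u₂ v v₁ u₁ v₁ u₂ v₁ in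
    (M1 H₂ < M1 H₁) × (M2 H₂ < M2 H₁)
lemma2p3 H simple _ v v₁ u₁ u₂ 3≤D vv₁ v₁-leaf u₁u₂ cycle =
  M1-decreases 3≤D , M2-decreases 3≤D 2≤h₁ 2≤h₂
  where
  2≤h₁ : 2 ≤ deg H u₁
  2≤h₁ = proj₁ (edgeOnCycle⇒deg≥2 simple u₁u₂ cycle)
  2≤h₂ : 2 ≤ deg H u₂
  2≤h₂ = proj₂ (edgeOnCycle⇒deg≥2 simple u₁u₂ cycle)
  ≢v₁ : ∀ {x} → 2 ≤ deg H x → x ≢ v₁
  ≢v₁ 2≤d refl = 1+n≰n (subst (2 ≤_) v₁-leaf 2≤d)
  open Rerouting H simple v v₁ u₁ u₂ vv₁ v₁-leaf u₁u₂ (≢v₁ 2≤h₁) (≢v₁ 2≤h₂)
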